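{- Let $G$ and $H$ be graphs of orders $m\geq 2$ and $n\geq 2$, respectively. Then $$\operatorname{dem}(G*H)=m\,c(H).$$
   Context: Throughout, all graphs are finite, simple, undirected and connected. For a graph $G$, a set $M\subseteq V(G)$ and an edge $e\in E(G)$, $P_G(M,e)$ is the set of pairs $(x,y)$ with $x\in M$, $y\in V(G)$ such that $d_G(x,y)\neq d_{G-e}(x,y)$. An edge $e$ is monitored by a vertex $x$ if $P_G(\{x\},e)\neq\emptyset$. A set $M\subseteq V(G)$ is a distance-edge-monitoring set if every edge of $G$ is monitored by some vertex of $M$; $\operatorname{dem}(G)$ is the minimum size of a distance-edge-monitoring set. $c(H)$ denotes the vertex cover number of $H$. The corona $G*H$, where $V(G)=\{u_1,\dots,u_m\}$, is obtained by taking one copy of $G$ and $m$ disjoint copies of $H$, and joining every vertex of the $i$-th copy of $H$ to $u_i$, for $i=1,\dots,m$. -}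

module Defs where

open import Data.Nat using (ℕ; zero; suc; _*_; _≤_; _<_)
open import Data.Fin using (Fin; zero; suc; remQuot; _≟_)
open import Data.Fin.Subset using (Subset; _∈_; ∣_∣)
open import Data.Maybe using (Maybe; just; nothing)
open import Data.Product using (Σ; ∃; _×_; _,_; proj₁; proj₂)
open import Data.Sum using (_⊎_; inj₁; inj₂)
open import Data.Empty using (⊥)
open import Relation.Nullary using (¬_; Dec; yes; no)
open import Relation.Nullary.Decidable using (_×-dec_; _⊎-dec_; ¬?)
open import Relation.Binary.PropositionalEquality using (_≡_; _≢_; refl; sym)

record Graph (n : ℕ) : Set₁ where
  field
    Adj    : Fin n → Fin n → Set
    adj?   : ∀ x y → Dec (Adj x y)
    symm   : ∀ {x y} → Adj x y → Adj y x
    irrefl : ∀ {x} → ¬ Adj x x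
open Graph public

Walk : ∀ {n} → Graph n → ℕ → Fin n → Fin n → Set
Walk G zero    x y = x ≡ y
Walk G (suc k) x y = Σ _ λ z → Adj G x z × Walk G k z y

Connected : ∀ {n} → Graph n → Set
Connected G = ∀ x y → ∃ λ k → Walk G k x y

-- Distance: just k = shortest walk has length k; nothing = infinity (no walk)
IsDist : ∀ {n} → Graph n → Fin n → Fin n → Maybe ℕ → Set
IsDist G x y (just k) = Walk G k x y × (∀ j → j < k → ¬ Walk G j x y)
IsDist G x y nothing  = ∀ k → ¬ Walk G k x y

deleteEdge : ∀ {n} (G : Graph n) (u v : Fin n) → Graph n
deleteEdge G u v = record
  { Adj    = λ x y → Adj G x y × ¬ ((x ≡ u × y ≡ v) ⊎ (x ≡ v × y ≡ u))
  ; adj?   = λ x y → adj? G x y ×-dec ¬? (((x ≟ u) ×-dec (y ≟ v)) ⊎-dec ((x ≟ v) ×-dec (y ≟ u)))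
  ; symm   = λ { (a , ne) → symm G a , λ { (inj₁ (p , q)) → ne (inj₂ (q , p))
                                        ; (inj₂ (p , q)) → ne (inj₁ (q , p)) } }
  ; irrefl = λ { (a , _) → irrefl G a }
  }

DistChanges : ∀ {n} (G : Graph n) (u v x y : Fin n) → Set
DistChanges G u v x y =
  Σ (Maybe ℕ) λ d → Σ (Maybe ℕ) λ d' →
    IsDist G x y d × IsDist (deleteEdge G u v) x y d' × d ≢ d'

InP : ∀ {n} (G : Graph n) (M : Subset n) (u v : Fin n) → Fin n × Fin n → Set
InP G M u v (x , y) = x ∈ M × DistChanges G u v x y

Monitors : ∀ {n} (G : Graph n) (x u v : Fin n) → Set
Monitors G x u v = ∃ λ y → DistChanges G u v x y

IsDEMSet : ∀ {n} → Graph n → Subset n → Set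
IsDEMSet G M = ∀ u v → Adj G u v → ∃ λ x → x ∈ M × Monitors G x u v

IsDem : ∀ {n} → Graph n → ℕ → Set
IsDem G k = (∃ λ M → IsDEMSet G M × ∣ M ∣ ≡ k) × (∀ M → IsDEMSet G M → k ≤ ∣ M ∣)

IsVertexCover : ∀ {n} → Graph n → Subset n → Set
IsVertexCover G S = ∀ u v → Adj G u v → u ∈ S ⊎ v ∈ S

IsVertexCoverNumber : ∀ {n} → Graph n → ℕ → Set
IsVertexCoverNumber G k =
  (∃ λ S → IsVertexCover G S × ∣ S ∣ ≡ k) × (∀ S → IsVertexCover G S → k ≤ ∣ S ∣)

-- Corona G * H.  Vertex (i , zero) is u_i; vertex (i , suc j) is vertex j
-- of the i-th copy of H.  Encoded in Fin (m * suc n) via remQuot.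
module _ {m n : ℕ} (G : Graph m) (H : Graph n) where
  CAdj : Fin m × Fin (suc n) → Fin m × Fin (suc n) → Set
  CAdj (i , zero)  (i' , zero)   = Adj G i i'
  CAdj (i , zero)  (i' , suc _)  = i ≡ i'
  CAdj (i , suc _) (i' , zero)   = i ≡ i'
  CAdj (i , suc j) (i' , suc j') = i ≡ i' × Adj H j j'

  cadj? : ∀ p q → Dec (CAdj p q)
  cadj? (i , zero)  (i' , zero)   = adj? G i i'
  cadj? (i , zero)  (i' , suc _)  = i ≟ i'
  cadj? (i , suc _) (i' , zero)   = i ≟ i'
  cadj? (i , suc j) (i' , suc j') = (i ≟ i') ×-dec adj? H j j'

  csym : ∀ {p q} → CAdj p q → CAdj q p
  csym {i , zero}  {i' , zero}  a = symm G a
  csym {i , zero}  {i' , suc _} a = sym a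
  csym {i , suc _} {i' , zero}  a = sym a
  csym {i , suc _} {i' , suc _} (e , a) = sym e , symm H a

  cirrefl : ∀ {p} → ¬ CAdj p p
  cirrefl {i , zero}  a       = irrefl G a
  cirrefl {i , suc _} (_ , a) = irrefl H a

  corona : Graph (m * suc n)
  corona = record
    { Adj    = λ x y → CAdj (remQuot (suc n) x) (remQuot (suc n) y)
    ; adj?   = λ x y → cadj? (remQuot (suc n) x) (remQuot (suc n) y)
    ; symm   = λ {x} {y} → csym {remQuot (suc n) x} {remQuot (suc n) y}
    ; irrefl = λ {x} → cirrefl {remQuot (suc n) x}
    }

{-# OPTIONS --safe #-}
-- Lower bound: an edge ab of the copy of H at u_i has u_i as a common neighbour, and u_i is
-- adjacent to every other neighbour of a and b; so a walk through ab can be rerouted through u_i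
-- at no cost, only a and b monitor ab, and every distance-edge-monitoring set meets each copy of H
-- in a vertex cover of H.  Upper bound: take a minimum vertex cover in every copy.  An edge of a
-- copy is monitored by its covered end; an edge u_i u_j of G by any vertex x of the i-th copy,
-- since x reaches u_j only through u_i; and a spoke u_i y by a vertex of another copy, which
-- reaches y only through u_i (here G is connected and m ≥ 2).
module Submission where

open import Data.Empty using (⊥-elim)
open import Data.Fin using (Fin; zero; suc; toℕ; _≟_; combine; remQuot)
open import Data.Fin.Properties using (any?; pigeonhole; toℕ≤pred[n]; remQuot-combine; combine-remQuot; combine-injectiveʳ)
open import Data.Fin.Subset using (Subset; inside; outside; _∈_; ∣_∣)
open import Data.Fin.Subset.Properties using (∣p∣≤∣x∷p∣)
open import Data.Maybe using (Maybe; just; nothing)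
open import Data.Nat using (ℕ; zero; suc; _+_; _*_; _∸_; _≤_; _<_; z≤n; s≤s; _<?_)
open import Data.Nat.Induction using (<-wellFounded)
open import Data.Nat.Properties using (≤-trans; ≤-antisym; ≮⇒≥; n≤1+n; n<1+n; m<n⇒m<1+n; m<1+n⇒m<n∨m≡n; ∸-monoʳ-<; +-mono-≤)
open import Data.Product using (Σ; ∃; ∃-syntax; _×_; _,_; proj₁; proj₂; uncurry)
open import Data.Sum using (_⊎_; inj₁; inj₂; [_,_]′)
open import Data.Vec using (Vec; []; _∷_; _++_; concat; replicate; group; lookup; tail; _[_]=_; there)
open import Data.Vec.Properties using (lookup-concat; lookup-replicate; lookup⇒[]=; []=⇒lookup)
open import Function using (_∘_)
open import Induction.WellFounded using (Acc; acc)
open import Relation.Binary.PropositionalEquality using (_≡_; _≢_; refl; sym; trans; cong; subst; subst₂; module ≡-Reasoning)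
open import Relation.Nullary using (¬_; Dec; yes; no)
open import Relation.Nullary.Decidable using (_×-dec_)

open import Defs

mapWalk : ∀ {n} {G G′ : Graph n} → (∀ {x y} → Adj G x y → Adj G′ x y) →
          ∀ {k x y} → Walk G k x y → Walk G′ k x y
mapWalk f {zero}  x≡y         = x≡y
mapWalk f {suc k} (z , a , w) = z , f a , mapWalk f w

_++ᵂ_ : ∀ {n} {G : Graph n} {k l x y z} → Walk G k x y → Walk G l y z → Walk G (k + l) x z
_++ᵂ_ {k = zero}  refl        w′ = w′
_++ᵂ_ {k = suc k} (z , a , w) w′ = z , a , w ++ᵂ w′

walk? : ∀ {n} (G : Graph n) k x y → Dec (Walk G k x y)
walk? G zero    x y = x ≟ y
walk? G (suc k) x y = any? (λ z → adj? G x z ×-dec walk? G k z y)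

module _ {n} {G : Graph n} where

  vertexAt : ∀ {k x y} → Walk G k x y → Fin (suc k) → Fin n
  vertexAt {x = x}   _           zero    = x
  vertexAt {suc k}   (_ , _ , w) (suc p) = vertexAt w p

  suffixFrom : ∀ {k x y} (w : Walk G k x y) (q : Fin (suc k)) → Walk G (k ∸ toℕ q) (vertexAt w q) y
  suffixFrom         w           zero    = w
  suffixFrom {suc k} (_ , _ , w) (suc q) = suffixFrom w q

  removeCycle : ∀ {k x y} (w : Walk G k x y) (p q : Fin (suc k)) → toℕ p < toℕ q →
                vertexAt w p ≡ vertexAt w q → ∃[ k′ ] k′ < k × Walk G k′ x y
  removeCycle {k} {y = y} w zero q 0<q x≡wq =
    k ∸ toℕ q , ∸-monoʳ-< 0<q (toℕ≤pred[n] q) , subst (λ v → Walk G _ v y) (sym x≡wq) (suffixFrom w q)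
  removeCycle {suc k} (z , a , w) (suc p) (suc q) (s≤s p<q) wp≡wq with removeCycle w p q p<q wp≡wq
  ... | k′ , k′<k , w′ = suc k′ , s≤s k′<k , z , a , w′

  shorterWalk : ∀ {k x y} → n ≤ k → Walk G k x y → ∃[ k′ ] k′ < k × Walk G k′ x y
  shorterWalk n≤k w with pigeonhole (s≤s n≤k) (vertexAt w)
  ... | p , q , p<q , wp≡wq = removeCycle w p q p<q wp≡wq

  walkShorterThanOrder : ∀ {k x y} → Walk G k x y → ∃[ k′ ] k′ < n × Walk G k′ x y
  walkShorterThanOrder w = go w (<-wellFounded _)
    where
    go : ∀ {k x y} → Walk G k x y → Acc _<_ k → ∃[ k′ ] k′ < n × Walk G k′ x y
    go {k} w (acc rec) with k <? n
    ... | yes k<n = k , k<n , w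
    ... | no k≮n with shorterWalk (≮⇒≥ k≮n) w
    ...   | k′ , k′<k , w′ = go w′ (rec k′<k)

  searchDistance : ∀ x y b → (∃[ k ] k < b × IsDist G x y (just k)) ⊎ (∀ j → j < b → ¬ Walk G j x y)
  searchDistance x y zero = inj₂ (λ _ ())
  searchDistance x y (suc b) with searchDistance x y b
  ... | inj₁ (k , k<b , d) = inj₁ (k , m<n⇒m<1+n k<b , d)
  ... | inj₂ none with walk? G b x y
  ...   | yes w = inj₁ (b , n<1+n b , w , none)
  ...   | no ¬w = inj₂ λ j j<1+b → [ none j , (λ { refl → ¬w }) ]′ (m<1+n⇒m<n∨m≡n j<1+b)

  distance : ∀ x y → Σ (Maybe ℕ) (IsDist G x y)
  distance x y with searchDistance x y n
  ... | inj₁ (k , _ , d) = just k , d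
  ... | inj₂ none        = nothing , λ k w → let (k′ , k′<n , w′) = walkShorterThanOrder w in none k′ k′<n w′

module _ {n} (G : Graph n) (u v : Fin n) where

  distChanges-if-lengthened : ∀ {x y} → (∃ λ k → Walk G k x y) →
    (∀ k → Walk (deleteEdge G u v) k x y → ∃[ t ] t < k × Walk G t x y) →
    DistChanges G u v x y
  distChanges-if-lengthened {x} {y} (k₀ , w₀) lengthened
    with distance {G = G} x y | distance {G = deleteEdge G u v} x y
  ... | d , D | d′ , D′ = d , d′ , D , D′ , differ d d′ D D′
    where
    differ : ∀ d d′ → IsDist G x y d → IsDist (deleteEdge G u v) x y d′ → d ≢ d′
    differ (just k) _ (_ , minimal) (w′ , _) refl with lengthened k w′
    ... | t , t<k , w = minimal t t<k w
    differ nothing _ none _ refl = none k₀ w₀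

  ¬distChanges-if-preserved : ∀ {x y} →
    (∀ k → Walk G k x y → ∃[ t ] t ≤ k × Walk (deleteEdge G u v) t x y) →
    ¬ DistChanges G u v x y
  ¬distChanges-if-preserved {x} {y} preserved (d , d′ , D , D′ , d≢d′) = d≢d′ (agree d d′ D D′)
    where
    agree : ∀ d d′ → IsDist G x y d → IsDist (deleteEdge G u v) x y d′ → d ≡ d′
    agree (just k) (just k′) (w , minimal) (w′ , minimal′) with preserved k w
    ... | t , t≤k , wt = cong just (≤-antisym (≮⇒≥ λ k<k′ → minimal k′ k<k′ (mapWalk proj₁ w′))
                                                (≤-trans (≮⇒≥ λ t<k′ → minimal′ t t<k′ wt) t≤k))
    agree (just k) nothing (w , _) none′ with preserved k w
    ... | t , _ , wt = ⊥-elim (none′ t wt)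
    agree nothing (just k′) none (w′ , _) = ⊥-elim (none k′ (mapWalk proj₁ w′))
    agree nothing nothing _ _ = refl

IsDist-map : ∀ {n} {G G′ : Graph n} → (∀ {x y} → Adj G x y → Adj G′ x y) → (∀ {x y} → Adj G′ x y → Adj G x y) →
             ∀ {x y} d → IsDist G x y d → IsDist G′ x y d
IsDist-map to from (just k) (w , minimal) = mapWalk to w , λ j j<k w′ → minimal j j<k (mapWalk from w′)
IsDist-map to from nothing  none          = λ k w → none k (mapWalk from w)

Monitors-flip : ∀ {n} (G : Graph n) {x u v} → Monitors G x u v → Monitors G x v u
Monitors-flip G {u = u} {v} (y , d , d′ , D , D′ , d≢d′) =
  y , d , d′ , D , IsDist-map (flipped u v) (flipped v u) d′ D′ , d≢d′
  where
  flipped : ∀ a b {x y} → Adj (deleteEdge G a b) x y → Adj (deleteEdge G b a) x y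
  flipped a b (xy , ¬ab) = xy , λ { (inj₁ e) → ¬ab (inj₂ e) ; (inj₂ e) → ¬ab (inj₁ e) }

-- From O the vertex v ∉ O is reached only through u, so in G − uv only by a detour longer than uv.
module _ {n} (G : Graph n) {u v : Fin n} (uv : Adj G u v) (O : Fin n → Set) (v∉O : ¬ O v)
         (closed : ∀ {z z′} → O z → z ≢ u → Adj G z z′ → O z′) where

  private
    lengthenedFrom : ∀ {z} → O z → ∀ k → Walk (deleteEdge G u v) k z v → ∃[ t ] t < k × Walk G t z v
    lengthenedFrom z∈O zero    z≡v = ⊥-elim (v∉O (subst O z≡v z∈O))
    lengthenedFrom {z} z∈O (suc k) (z′ , (zz′ , ¬uv) , w) with z ≟ u
    ... | yes refl = throughEdge k ¬uv w
      where
      throughEdge : ∀ k → ¬ ((u ≡ u × z′ ≡ v) ⊎ (u ≡ v × z′ ≡ u)) → Walk (deleteEdge G u v) k z′ v →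
                    ∃[ t ] t < suc k × Walk G t u v
      throughEdge zero    ¬uv z′≡v = ⊥-elim (¬uv (inj₁ (refl , z′≡v)))
      throughEdge (suc k) _   _    = 1 , s≤s (s≤s z≤n) , v , uv , refl
    ... | no z≢u with lengthenedFrom (closed z∈O z≢u zz′) k w
    ...   | t , t<k , w′ = suc t , s≤s t<k , z′ , zz′ , w′

  monitors-beyond-edge : ∀ {x} → O x → (∃ λ k → Walk G k x v) → Monitors G x u v
  monitors-beyond-edge x∈O reach = v , distChanges-if-lengthened G u v reach (lengthenedFrom x∈O)

endpoint-monitors : ∀ {n} (G : Graph n) {u v} → Adj G u v → Monitors G u u v
endpoint-monitors G {u} uv =
  monitors-beyond-edge G uv (_≡ u) (λ v≡u → irrefl G (subst (Adj G u) v≡u uv))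
    (λ z≡u z≢u _ → ⊥-elim (z≢u z≡u)) refl (1 , _ , uv , refl)

-- A walk through the edge ab can be rerouted through w without becoming longer.
module _ {n} (G : Graph n) {a b w : Fin n} (ab : Adj G a b) (w≢a : w ≢ a) (w≢b : w ≢ b)
         (dominates : ∀ s → Adj G a s ⊎ Adj G b s → s ≡ w ⊎ Adj G s w) where

  private
    G⁻ = deleteEdge G a b

    data Ends : Fin n → Fin n → Set where
      a⇒b : Ends a b
      b⇒a : Ends b a

    flip : ∀ {c c′} → Ends c c′ → Ends c′ c
    flip a⇒b = b⇒a
    flip b⇒a = a⇒b

    dominatedFrom : ∀ {c c′ s} → Ends c c′ → Adj G c s → s ≡ w ⊎ Adj G s w
    dominatedFrom a⇒b cs = dominates _ (inj₁ cs)
    dominatedFrom b⇒a cs = dominates _ (inj₂ cs)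

    adjacent-to-w : ∀ {s} → w ≢ s → s ≡ w ⊎ Adj G s w → Adj G w s
    adjacent-to-w w≢s (inj₁ s≡w) = ⊥-elim (w≢s (sym s≡w))
    adjacent-to-w _   (inj₂ sw)  = symm G sw

    w-adj : ∀ {c c′} → Ends c c′ → Adj G w c′
    w-adj a⇒b = adjacent-to-w w≢b (dominates _ (inj₁ ab))
    w-adj b⇒a = adjacent-to-w w≢a (dominates _ (inj₂ (symm G ab)))

    avoids : ∀ {c c′ z} → Ends c c′ → z ≢ c → z ≢ c′ → z ≢ a × z ≢ b
    avoids a⇒b z≢c z≢c′ = z≢c , z≢c′
    avoids b⇒a z≢c z≢c′ = z≢c′ , z≢c

    keepˡ : ∀ {s t} → s ≢ a → s ≢ b → Adj G s t → Adj G⁻ s t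
    keepˡ s≢a s≢b st = st , λ { (inj₁ (s≡a , _)) → s≢a s≡a ; (inj₂ (s≡b , _)) → s≢b s≡b }

    keepʳ : ∀ {s t} → t ≢ a → t ≢ b → Adj G s t → Adj G⁻ s t
    keepʳ t≢a t≢b st = st , λ { (inj₁ (_ , t≡b)) → t≢b t≡b ; (inj₂ (_ , t≡a)) → t≢a t≡a }

    NoLonger : ℕ → Fin n → Fin n → Set
    NoLonger k s y = ∃[ j ] j ≤ k × Walk G⁻ j s y

    mutual
      reroute : ∀ k {s y} → s ≢ a → s ≢ b → Walk G k s y → NoLonger k s y
      reroute zero    _   _   s≡y           = 0 , z≤n , s≡y
      reroute (suc k) s≢a s≢b (z , sz , wk) with z ≟ a | z ≟ b
      ... | yes refl | _        = rerouteFrom k a⇒b s≢a s≢b sz wk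
      ... | no _     | yes refl = rerouteFrom k b⇒a s≢a s≢b sz wk
      ... | no z≢a   | no z≢b with reroute k z≢a z≢b wk
      ...   | j , j≤k , w′ = suc j , s≤s j≤k , z , keepˡ s≢a s≢b sz , w′

      rerouteFrom : ∀ k {c c′ s y} → Ends c c′ → s ≢ a → s ≢ b → Adj G s c → Walk G k c y → NoLonger (suc k) s y
      rerouteFrom zero    {c} ends s≢a s≢b sc c≡y = 1 , s≤s z≤n , c , keepˡ s≢a s≢b sc , c≡y
      rerouteFrom (suc k) {c} {c′} ends s≢a s≢b sc (z , cz , wk) with z ≟ c′
      ... | no z≢c′ with avoids ends (λ z≡c → irrefl G (subst (Adj G c) z≡c cz)) z≢c′
      ...   | z≢a , z≢b with reroute k z≢a z≢b wk
      ...     | j , j≤k , w′ = suc (suc j) , s≤s (s≤s j≤k) , c , keepˡ s≢a s≢b sc , z , keepʳ z≢a z≢b cz , w′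
      rerouteFrom (suc k) ends s≢a s≢b sc (_ , _ , wk) | yes refl
        with rerouteFrom k (flip ends) w≢a w≢b (w-adj ends) wk | dominatedFrom ends (symm G sc)
      ... | j , j≤1+k , w′ | inj₁ refl = j , ≤-trans j≤1+k (n≤1+n _) , w′
      ... | j , j≤1+k , w′ | inj₂ sw   = suc j , s≤s j≤1+k , w , keepˡ s≢a s≢b sw , w′

  onlyEndpointsMonitor : ∀ {x} → Monitors G x a b → x ≡ a ⊎ x ≡ b
  onlyEndpointsMonitor {x} (y , changes) with x ≟ a | x ≟ b
  ... | yes x≡a | _       = inj₁ x≡a
  ... | no _    | yes x≡b = inj₂ x≡b
  ... | no x≢a  | no x≢b  = ⊥-elim (¬distChanges-if-preserved G a b (λ k → reroute k x≢a x≢b) changes)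

∣p++q∣≡∣p∣+∣q∣ : ∀ {k l} (p : Subset k) (q : Subset l) → ∣ p ++ q ∣ ≡ ∣ p ∣ + ∣ q ∣
∣p++q∣≡∣p∣+∣q∣ []            q = refl
∣p++q∣≡∣p∣+∣q∣ (inside  ∷ p) q = cong suc (∣p++q∣≡∣p∣+∣q∣ p q)
∣p++q∣≡∣p∣+∣q∣ (outside ∷ p) q = ∣p++q∣≡∣p∣+∣q∣ p q

∣concat-replicate∣ : ∀ m {k} (p : Subset k) → ∣ concat (replicate m p) ∣ ≡ m * ∣ p ∣
∣concat-replicate∣ zero    p = refl
∣concat-replicate∣ (suc m) p = trans (∣p++q∣≡∣p∣+∣q∣ p _) (cong (∣ p ∣ +_) (∣concat-replicate∣ m p))

∣concat∣-lowerBound : ∀ {m k c} (ps : Vec (Subset k) m) → (∀ i → c ≤ ∣ lookup ps i ∣) → m * c ≤ ∣ concat ps ∣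
∣concat∣-lowerBound []       _     = z≤n
∣concat∣-lowerBound (p ∷ ps) bound = subst (_ ≤_) (sym (∣p++q∣≡∣p∣+∣q∣ p (concat ps)))
  (+-mono-≤ (bound zero) (∣concat∣-lowerBound ps (bound ∘ suc)))

∣tail∣≤ : ∀ {k} (p : Subset (suc k)) → ∣ tail p ∣ ≤ ∣ p ∣
∣tail∣≤ (x ∷ p) = ∣p∣≤∣x∷p∣ x p

module Corona {m n : ℕ} (G : Graph m) (H : Graph n) where

  C : Graph (m * suc n)
  C = corona G H

  encode : Fin m × Fin (suc n) → Fin (m * suc n)
  encode = uncurry combine

  hub : Fin m → Fin (m * suc n)
  hub i = combine i zero

  copyVertex : Fin m → Fin n → Fin (m * suc n)
  copyVertex i j = combine i (suc j)

  decode : Fin (m * suc n) → Fin m × Fin (suc n)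
  decode = remQuot {m} (suc n)

  decode-encode : ∀ p → decode (encode p) ≡ p
  decode-encode (i , t) = remQuot-combine i t

  encode-decode : ∀ x → encode (decode x) ≡ x
  encode-decode = combine-remQuot {m} (suc n)

  encodeAdj : ∀ {p q} → CAdj G H p q → Adj C (encode p) (encode q)
  encodeAdj {p} {q} = subst₂ (CAdj G H) (sym (decode-encode p)) (sym (decode-encode q))

  decodeAdj : ∀ {p q} → Adj C (encode p) (encode q) → CAdj G H p q
  decodeAdj {p} {q} = subst₂ (CAdj G H) (decode-encode p) (decode-encode q)

  elimVertex : (P : Fin (m * suc n) → Set) → (∀ p → P (encode p)) → ∀ x → P x
  elimVertex P h x = subst P (encode-decode x) (h (decode x))

  liftWalk : ∀ {k i i′} → Walk G k i i′ → Walk C k (hub i) (hub i′)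
  liftWalk {zero}  refl        = refl
  liftWalk {suc k} {i} (z , a , w) = hub z , encodeAdj {i , zero} {z , zero} a , liftWalk w

  hub≢copyVertex : ∀ {i j} → hub i ≢ copyVertex i j
  hub≢copyVertex {i} {j} eq with combine-injectiveʳ i zero i (suc j) eq
  ... | ()

  hub-dominates-copy : ∀ {i j} s → Adj C (copyVertex i j) s → s ≡ hub i ⊎ Adj C s (hub i)
  hub-dominates-copy {i} {j} = elimVertex (λ s → Adj C (copyVertex i j) s → s ≡ hub i ⊎ Adj C s (hub i)) dominated
    where
    dominated : ∀ p → Adj C (copyVertex i j) (encode p) → encode p ≡ hub i ⊎ Adj C (encode p) (hub i)
    dominated (i′ , zero)  a = inj₁ (cong hub (sym (decodeAdj {i , suc j} {i′ , zero} a)))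
    dominated (i′ , suc t) a = inj₂ (encodeAdj {i′ , suc t} {i , zero} (sym (proj₁ (decodeAdj {i , suc j} {i′ , suc t} a))))

  copyEdge-monitoredOnlyByEnds : ∀ {i j j′ x} → Adj H j j′ → Monitors C x (copyVertex i j) (copyVertex i j′) →
                                 x ≡ copyVertex i j ⊎ x ≡ copyVertex i j′
  copyEdge-monitoredOnlyByEnds {i} {j} {j′} jj′ =
    onlyEndpointsMonitor C (encodeAdj {i , suc j} {i , suc j′} (refl , jj′)) hub≢copyVertex hub≢copyVertex
      (λ s → [ hub-dominates-copy s , hub-dominates-copy s ]′)

  blocks : Subset (m * suc n) → Vec (Subset (suc n)) m
  blocks M = proj₁ (group m (suc n) M)

  ∈-block : ∀ M {i j} → copyVertex i j ∈ M → j ∈ tail (lookup (blocks M) i)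
  ∈-block M {i} {j} x∈M = ∈-tail (lookup⇒[]= (suc j) (lookup (blocks M) i) (begin
      lookup (lookup (blocks M) i) (suc j)          ≡⟨ lookup-concat (blocks M) i (suc j) ⟨
      lookup (concat (blocks M)) (copyVertex i j)   ≡⟨ cong (λ M′ → lookup M′ (copyVertex i j)) (proj₂ (group m (suc n) M)) ⟨
      lookup M (copyVertex i j)                     ≡⟨ []=⇒lookup x∈M ⟩
      inside                                        ∎))
    where
    open ≡-Reasoning
    ∈-tail : ∀ {k} {p : Subset (suc k)} {j} → p [ suc j ]= inside → j ∈ tail p
    ∈-tail (there j∈p) = j∈p

  block-isVertexCover : ∀ M → IsDEMSet C M → ∀ i → IsVertexCover H (tail (lookup (blocks M) i))
  block-isVertexCover M isDEM i j j′ jj′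
    with isDEM (copyVertex i j) (copyVertex i j′) (encodeAdj {i , suc j} {i , suc j′} (refl , jj′))
  ... | x , x∈M , monitors with copyEdge-monitoredOnlyByEnds jj′ monitors
  ...   | inj₁ refl = inj₁ (∈-block M x∈M)
  ...   | inj₂ refl = inj₂ (∈-block M x∈M)

  dem-lowerBound : ∀ {c} → (∀ S → IsVertexCover H S → c ≤ ∣ S ∣) → ∀ M → IsDEMSet C M → m * c ≤ ∣ M ∣
  dem-lowerBound {c} minimal M isDEM =
    subst (λ M′ → m * c ≤ ∣ M′ ∣) (sym (proj₂ (group m (suc n) M)))
      (∣concat∣-lowerBound (blocks M) λ i → ≤-trans (minimal _ (block-isVertexCover M isDEM i)) (∣tail∣≤ (lookup (blocks M) i)))

  coverSet : Subset n → Subset (m * suc n)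
  coverSet S = concat (replicate m (outside ∷ S))

  ∣coverSet∣ : ∀ S → ∣ coverSet S ∣ ≡ m * ∣ S ∣
  ∣coverSet∣ S = ∣concat-replicate∣ m (outside ∷ S)

  ∈-coverSet : ∀ {S i j} → j ∈ S → copyVertex i j ∈ coverSet S
  ∈-coverSet {S} {i} {j} j∈S = lookup⇒[]= (copyVertex i j) (coverSet S) (begin
    lookup (coverSet S) (copyVertex i j)                  ≡⟨ lookup-concat (replicate m (outside ∷ S)) i (suc j) ⟩
    lookup (lookup (replicate m (outside ∷ S)) i) (suc j) ≡⟨ cong (λ p → lookup p (suc j)) (lookup-replicate i (outside ∷ S)) ⟩
    lookup S j                                            ≡⟨ []=⇒lookup j∈S ⟩
    inside                                                ∎)
    where open ≡-Reasoning

  monitors-beyond-coronaEdge : (P : Fin m × Fin (suc n) → Set) {p q : Fin m × Fin (suc n)} → CAdj G H p q → ¬ P q →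
    (∀ {r r′} → P r → r ≢ p → CAdj G H r r′ → P r′) →
    ∀ {x} → P x → (∃ λ k → Walk C k (encode x) (encode q)) → Monitors C (encode x) (encode p) (encode q)
  monitors-beyond-coronaEdge P {p} {q} pq ¬Pq closed {x} Px =
    monitors-beyond-edge C (encodeAdj {p} {q} pq) (P ∘ decode) (¬Pq ∘ subst P (decode-encode q))
      (λ {z} Pz z≢p zz′ → closed Pz (λ eq → z≢p (trans (sym (encode-decode z)) (cong encode eq))) zz′)
      (subst P (sym (decode-encode x)) Px)

  hubEdge-monitored : ∀ {i i′} j → Adj G i i′ → Monitors C (copyVertex i j) (hub i) (hub i′)
  hubEdge-monitored {i} {i′} j ii′ =
    monitors-beyond-coronaEdge (λ p → proj₁ p ≡ i) {i , zero} {i′ , zero} ii′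
      (λ i′≡i → irrefl G (subst (Adj G i) i′≡i ii′)) closed refl
      (2 , hub i , encodeAdj {i , suc j} {i , zero} refl , hub i′ , encodeAdj {i , zero} {i′ , zero} ii′ , refl)
    where
    closed : ∀ {r r′} → proj₁ r ≡ i → r ≢ (i , zero) → CAdj G H r r′ → proj₁ r′ ≡ i
    closed {_ , zero}  refl r≢hub _ = ⊥-elim (r≢hub refl)
    closed {_ , suc _} {_ , zero}  refl _ i≡i₂        = sym i≡i₂
    closed {_ , suc _} {_ , suc _} refl _ (i≡i₂ , _)  = sym i≡i₂

  OutsideCopy : Fin m → Fin m × Fin (suc n) → Set
  OutsideCopy i (i₁ , t) = t ≡ zero ⊎ i₁ ≢ i

  spoke-monitored : Connected G → ∀ {i i′} → i′ ≢ i → ∀ j j′ → Monitors C (copyVertex i′ j) (hub i) (copyVertex i j′)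
  spoke-monitored connected {i} {i′} i′≢i j j′ =
    monitors-beyond-coronaEdge (OutsideCopy i) {i , zero} {i , suc j′} refl (λ { (inj₁ ()) ; (inj₂ i≢i) → i≢i refl })
      closed (inj₂ i′≢i)
      (suc (k + 1) , hub i′ , encodeAdj {i′ , suc j} {i′ , zero} refl ,
        liftWalk w ++ᵂ (copyVertex i j′ , encodeAdj {i , zero} {i , suc j′} refl , refl))
    where
    k = proj₁ (connected i′ i)
    w = proj₂ (connected i′ i)
    closed : ∀ {r r′} → OutsideCopy i r → r ≢ (i , zero) → CAdj G H r r′ → OutsideCopy i r′
    closed {r′ = _ , zero} _ _ _ = inj₁ refl
    closed {_ , zero}  {_ , suc _} _ r≢hub i₁≡i₂ = inj₂ λ i₂≡i → r≢hub (cong (_, zero) (trans i₁≡i₂ i₂≡i))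
    closed {_ , suc _} {_ , suc _} (inj₁ ())
    closed {_ , suc _} {_ , suc _} (inj₂ i₁≢i) _ (i₁≡i₂ , _) = inj₂ (i₁≢i ∘ trans i₁≡i₂)

  coverSet-isDEMSet : Connected G → (∀ i → ∃ λ i′ → i′ ≢ i) →
                      ∀ {S j₀} → IsVertexCover H S → j₀ ∈ S → IsDEMSet C (coverSet S)
  coverSet-isDEMSet connected another {S} {j₀} cover j₀∈S =
    elimVertex (λ u → ∀ v → Adj C u v → Monitored u v) λ p → elimVertex (λ v → Adj C (encode p) v → Monitored (encode p) v) (monitored p)
    where
    Monitored : Fin (m * suc n) → Fin (m * suc n) → Set
    Monitored u v = ∃ λ x → x ∈ coverSet S × Monitors C x u v
    monitored : ∀ p q → Adj C (encode p) (encode q) → Monitored (encode p) (encode q)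
    monitored (i , zero) (i′ , zero) a =
      copyVertex i j₀ , ∈-coverSet j₀∈S , hubEdge-monitored j₀ (decodeAdj {i , zero} {i′ , zero} a)
    monitored (i , zero) (i′ , suc j′) a with decodeAdj {i , zero} {i′ , suc j′} a | another i
    ... | refl | i″ , i″≢i = copyVertex i″ j₀ , ∈-coverSet j₀∈S , spoke-monitored connected i″≢i j₀ j′
    monitored (i , suc j) (i′ , zero) a with monitored (i′ , zero) (i , suc j) (symm C a)
    ... | x , x∈M , monitors = x , x∈M , Monitors-flip C monitors
    monitored (i , suc j) (i′ , suc j′) a with decodeAdj {i , suc j} {i′ , suc j′} a
    ... | refl , jj′ with cover j j′ jj′
    ...   | inj₁ j∈S  = copyVertex i j , ∈-coverSet j∈S , endpoint-monitors C a
    ...   | inj₂ j′∈S = copyVertex i j′ , ∈-coverSet j′∈S , Monitors-flip C (endpoint-monitors C (symm C a))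

vertexCover-nonempty : ∀ {n} (H : Graph n) → 2 ≤ n → Connected H → ∀ {S} → IsVertexCover H S → ∃ λ j → j ∈ S
vertexCover-nonempty H (s≤s (s≤s z≤n)) connected cover with connected zero (suc zero)
... | zero  , ()
... | suc _ , z , a , _ = [ (zero ,_) , (z ,_) ]′ (cover zero z a)

another : ∀ {m} → 2 ≤ m → (i : Fin m) → ∃ λ i′ → i′ ≢ i
another (s≤s (s≤s z≤n)) zero    = suc zero , λ ()
another (s≤s (s≤s z≤n)) (suc i) = zero , λ ()

mainTheorem2 : (m n : ℕ) (G : Graph m) (H : Graph n) →
    2 ≤ m → 2 ≤ n → Connected G → Connected H →
    (c : ℕ) → IsVertexCoverNumber H c →
    IsDem (corona G H) (m * c)
mainTheorem2 m n G H 2≤m 2≤n connectedG connectedH c ((S , cover , ∣S∣≡c) , minimal) =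
  (coverSet S , isDEM , trans (∣coverSet∣ S) (cong (m *_) ∣S∣≡c)) , dem-lowerBound minimal
  where
  open Corona G H
  isDEM : IsDEMSet C (coverSet S)
  isDEM = coverSet-isDEMSet connectedG (another 2≤m) cover (proj₂ (vertexCover-nonempty H 2≤n connectedH cover))
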